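{- Let $\mathsf{AP}$ be any finite set of atomic propositions. Then $\mathsf{LTL}[\mathsf{AP}]$ admits finite characterizations over $\mathcal{W}^{\mathsf{fin}}$ by (not necessarily simple) schematic examples: for every $\mathsf{LTL}[\mathsf{AP}]$-formula $\varphi$ there is a finite set $E$ of labeled schematic examples such that $\varphi$ fits every element of $E$ and every $\mathsf{LTL}[\mathsf{AP}]$-formula $\psi$ fitting every element of $E$ satisfies $[\![\psi]\!]\cap\mathcal{W}^{\mathsf{fin}}=[\![\varphi]\!]\cap\mathcal{W}^{\mathsf{fin}}$.
   Context: $\mathcal{W}^{\mathsf{fin}}$ is the set of finite words over the alphabet $\Sigma=2^{\mathsf{AP}}$; for $i<|w|$, $w[i..]$ is the suffix starting at position $i$. LTL syntax: $\varphi::=\top\mid p\mid\neg\varphi\mid\varphi\land\varphi\mid\mathsf{X}\varphi\mid\mathsf{F}\varphi\mid\varphi\,\mathsf{U}\,\varphi$ with $p\in\mathsf{AP}$. Semantics on a word $w$: $w\models\top$ always; $w\models p$ iff $p\in w[0]$; $\neg,\land$ as usual; $w\models\mathsf{X}\varphi$ iff $|w|>1$ and $w[1..]\models\varphi$; $w\models\mathsf{F}\varphi$ iff there is $i<|w|$ with $w[i..]\models\varphi$; $w\models\varphi\,\mathsf{U}\,\psi$ iff there is $j<|w|$ with $w[j..]\models\psi$ and $w[i..]\models\varphi$ for all $i<j$. $[\![\varphi]\!]\cap\mathcal{W}^{\mathsf{fin}}$ is the set of finite words satisfying $\varphi$. Schematic examples: let $\mathbb{B}(\mathsf{AP})$ be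 the set of Boolean expressions over $\mathsf{AP}$; each $b\in\mathbb{B}(\mathsf{AP})$ denotes the set of letters $\sigma\in\Sigma$ satisfying it. A schematic example is a union-free regular expression $r$ over the alphabet $\mathbb{B}(\mathsf{AP})$ (built using concatenation and Kleene star, without union), denoting a language $L(r)\subseteq\Sigma^*$; it is simple if its star height is at most 1. $\varphi$ fits the labeled schematic example $(r,+)$ if $L(r)\subseteq[\![\varphi]\!]$, and fits $(r,-)$ if $L(r)\cap[\![\varphi]\!]=\emptyset$. -}

module Defs where

open import Data.Nat using (ℕ; zero; suc; _<_)
open import Data.Fin using (Fin; zero; suc; toℕ; fromℕ<)
open import Data.Fin.Subset using (Subset) renaming (_∈_ to _∈ₛ_)
open import Data.Bool using (Bool; true; false)
open import Data.List using (List; []; _∷_; _++_)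
open import Data.List.NonEmpty using (List⁺; _∷_) renaming (length to length⁺)
open import Data.Product using (Σ; ∃; _×_; _,_)
open import Data.Sum using (_⊎_)
open import Data.Empty using (⊥)
open import Data.Unit using (⊤)
open import Relation.Nullary using (¬_)

-- Atomic propositions: AP = Fin n (any finite set, up to renaming).
-- Letters: Σ = 2^AP.
Letter : ℕ → Set
Letter n = Subset n

Word : ℕ → Set
Word n = List⁺ (Letter n)

∣_∣ : ∀ {n} → Word n → ℕ
∣ w ∣ = length⁺ w

suffix : ∀ {n} (w : Word n) → Fin ∣ w ∣ → Word n
suffix (x ∷ xs) zero = x ∷ xs
suffix (x ∷ (y ∷ ys)) (suc i) = suffix (y ∷ ys) i

data LTL (n : ℕ) : Set where
  ⊤ₗ  : LTL n
  atom : Fin n → LTL n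
  ¬ₗ_  : LTL n → LTL n
  _∧ₗ_ : LTL n → LTL n → LTL n
  Xₗ   : LTL n → LTL n
  Fₗ   : LTL n → LTL n
  _Uₗ_ : LTL n → LTL n → LTL n

_⊨_ : ∀ {n} → Word n → LTL n → Set
w ⊨ ⊤ₗ = ⊤
(a ∷ _) ⊨ atom p = p ∈ₛ a
w ⊨ (¬ₗ φ) = ¬ (w ⊨ φ)
w ⊨ (φ ∧ₗ ψ) = (w ⊨ φ) × (w ⊨ ψ)
w ⊨ Xₗ φ = Σ (1 < ∣ w ∣) λ p → suffix w (fromℕ< p) ⊨ φ
w ⊨ Fₗ φ = ∃ λ (i : Fin ∣ w ∣) → suffix w i ⊨ φ
w ⊨ (φ Uₗ ψ) = ∃ λ (j : Fin ∣ w ∣) →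
  (suffix w j ⊨ ψ) × (∀ (i : Fin ∣ w ∣) → toℕ i < toℕ j → suffix w i ⊨ φ)

data BExp (n : ℕ) : Set where
  trueᵇ : BExp n
  varᵇ  : Fin n → BExp n
  notᵇ  : BExp n → BExp n
  andᵇ  : BExp n → BExp n → BExp n
  orᵇ   : BExp n → BExp n → BExp n

_⊨ᵇ_ : ∀ {n} → Letter n → BExp n → Set
σ ⊨ᵇ trueᵇ = ⊤
σ ⊨ᵇ varᵇ p = p ∈ₛ σ
σ ⊨ᵇ notᵇ b = ¬ (σ ⊨ᵇ b)
σ ⊨ᵇ andᵇ b c = (σ ⊨ᵇ b) × (σ ⊨ᵇ c)
σ ⊨ᵇ orᵇ b c = (σ ⊨ᵇ b) ⊎ (σ ⊨ᵇ c)

-- Schematic examples: union-free regular expressions over BExp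
-- (concatenation and Kleene star, no union; star height unrestricted).
data SchEx (n : ℕ) : Set where
  lit  : BExp n → SchEx n
  _·_  : SchEx n → SchEx n → SchEx n
  _⋆   : SchEx n → SchEx n

data _∈L_ {n : ℕ} : List (Letter n) → SchEx n → Set where
  lit∈  : ∀ {σ b} → σ ⊨ᵇ b → (σ ∷ []) ∈L lit b
  cat∈  : ∀ {u v r s} → u ∈L r → v ∈L s → (u ++ v) ∈L (r · s)
  nil⋆  : ∀ {r} → [] ∈L (r ⋆)
  cons⋆ : ∀ {u v r} → u ∈L r → v ∈L (r ⋆) → (u ++ v) ∈L (r ⋆)

-- Membership of a word of Σ* in [[φ]] ∩ W^fin (the empty word is not in W^fin).
_∈⟦_⟧ : ∀ {n} → List (Letter n) → LTL n → Set
[] ∈⟦ φ ⟧ = ⊥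
(a ∷ as) ∈⟦ φ ⟧ = (a ∷ as) ⊨ φ

data Label : Set where
  pos neg : Label

LabeledEx : ℕ → Set
LabeledEx n = SchEx n × Label

Fits : ∀ {n} → LTL n → LabeledEx n → Set
Fits φ (r , pos) = ∀ w → w ∈L r → w ∈⟦ φ ⟧
Fits φ (r , neg) = ∀ w → w ∈L r → ¬ (w ∈⟦ φ ⟧)

{-# OPTIONS --safe #-}
-- The finite words satisfying φ form a regular language: reading a word from its
-- last letter, the vector of truth values of all subformulas of φ is updated by
-- a local rule, so it is the state of a finite automaton.  Kleene's construction,
-- with unions pushed outwards and (r₁ + ⋯ + rₖ)* rewritten as (r₁* ⋯ rₖ*)*,
-- expresses each set {w | the automaton reaches q on w} as a finite union of
-- union-free expressions.  Labelling every such expression by whether q is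
-- accepting gives the sample: a formula ψ fitting it agrees with φ on every such
-- set, and these sets cover all words.
module Submission where

open import Defs
open import Data.Nat using (ℕ)
open import Data.List using (List)
open import Data.List.Relation.Unary.All using (All)
open import Data.Product using (Σ; _×_)
open import Function.Bundles using (_⇔_)

open import Data.Bool using (Bool; true; false; T; not; _∧_; _∨_)
import Data.Bool.Properties as Bool
open import Data.Empty using (⊥-elim)
open import Data.Fin using (Fin; zero; suc)
open import Data.Fin.Subset using () renaming (_∈_ to _∈ₛ_)
open import Data.List
  using ( []; _∷_; _++_; [_]; map; foldr; filter; tabulate; concatMap
        ; cartesianProduct; cartesianProductWith)
open import Data.List.NonEmpty using () renaming (_∷_ to _∷⁺_)
open import Data.List.Properties using (++-assoc; ++-identityʳ)
open import Data.List.Membership.Propositional using (_∈_; find; lose)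
open import Data.List.Membership.Propositional.Properties
  using ( ∈-map⁺; ∈-map⁻; ∈-filter⁺; ∈-filter⁻; ∈-concatMap⁺; ∈-concatMap⁻
        ; ∈-cartesianProduct⁺; ∈-cartesianProductWith⁺; ∈-cartesianProductWith⁻)
open import Data.List.Relation.Unary.Any using (Any; here; there)
import Data.List.Relation.Unary.Any.Properties as Any
import Data.List.Relation.Unary.All as All
import Data.List.Relation.Unary.All.Properties as AllP
open import Data.Nat using (zero; suc; s≤s; z≤n)
open import Data.Product using (∃₂; _,_; proj₁; proj₂)
open import Data.Product.Function.NonDependent.Propositional using (_×-⇔_)
import Data.Product.Properties as Product
open import Data.Sum using (_⊎_; inj₁; inj₂)
open import Data.Sum.Function.Propositional using (_⊎-⇔_)
open import Data.Unit using (⊤; tt)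
import Data.Unit.Properties as Unit
open import Data.Vec using (Vec; lookup)
import Data.Vec as Vec
open import Data.Vec.Properties using (lookup⇒[]=; []=⇒lookup; tabulate∘lookup; tabulate-cong)
import Data.Vec.Properties as Vecₚ
open import Function.Base using (_∘_)
open import Function.Bundles using (Equivalence; mk⇔)
open import Function.Properties.Equivalence using () renaming (sym to ⇔-sym; trans to ⇔-trans)
open import Function.Related.TypeIsomorphisms using (¬-cong-⇔)
open import Relation.Binary.Definitions using (DecidableEquality)
open import Relation.Binary.PropositionalEquality using (_≡_; refl; sym; trans; cong; cong₂; subst)
open import Relation.Nullary using (¬_)

record Finite (A : Set) : Set where
  field
    elements : List A
    complete : ∀ x → x ∈ elements
    _≟_      : DecidableEquality A

finite-⊤ : Finite ⊤
finite-⊤ = record { elements = [ tt ] ; complete = λ _ → here refl ; _≟_ = Unit._≟_ }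

finite-Bool : Finite Bool
finite-Bool = record
  { elements = true ∷ false ∷ []
  ; complete = λ { true → here refl ; false → there (here refl) }
  ; _≟_      = Bool._≟_
  }

finite-× : ∀ {A B} → Finite A → Finite B → Finite (A × B)
finite-× FA FB = record
  { elements = cartesianProduct (Finite.elements FA) (Finite.elements FB)
  ; complete = λ (x , y) → ∈-cartesianProduct⁺ (Finite.complete FA x) (Finite.complete FB y)
  ; _≟_      = Product.≡-dec (Finite._≟_ FA) (Finite._≟_ FB)
  }

finite-Vec : ∀ {A : Set} → Finite A → ∀ k → Finite (Vec A k)
finite-Vec {A} FA k = record
  { elements = vectors k
  ; complete = complete
  ; _≟_      = Vecₚ.≡-dec (Finite._≟_ FA)
  }
  where
    vectors : ∀ k → List (Vec A k)
    vectors zero    = [ Vec.[] ]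
    vectors (suc k) = cartesianProductWith Vec._∷_ (Finite.elements FA) (vectors k)

    complete : ∀ {k} (xs : Vec A k) → xs ∈ vectors k
    complete Vec.[]       = here refl
    complete (x Vec.∷ xs) = ∈-cartesianProductWith⁺ Vec._∷_ (Finite.complete FA x) (complete xs)

finite-Letter : ∀ n → Finite (Letter n)
finite-Letter = finite-Vec finite-Bool

private
  variable
    n : ℕ
    σ σ′ : Letter n
    p : Fin n
    u v w : List (Letter n)
    r : SchEx n
    rs ss : List (SchEx n)

∈ₛ⇔lookup : p ∈ₛ σ ⇔ lookup σ p ≡ true
∈ₛ⇔lookup {p = p} {σ = σ} = mk⇔ []=⇒lookup (lookup⇒[]= p σ)

literal : Fin n → Bool → BExp n
literal i true  = varᵇ i
literal i false = notᵇ (varᵇ i)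

⊨ᵇ-literal : ∀ b → σ ⊨ᵇ literal p b ⇔ lookup σ p ≡ b
⊨ᵇ-literal true  = ∈ₛ⇔lookup
⊨ᵇ-literal false = mk⇔ (λ p∉σ → Bool.¬-not (p∉σ ∘ Equivalence.from ∈ₛ⇔lookup))
                       (λ { eq p∈σ → Bool.not-¬ eq (Equivalence.to ∈ₛ⇔lookup p∈σ) })

⋀ : List (BExp n) → BExp n
⋀ = foldr andᵇ trueᵇ

⊨ᵇ-⋀ : ∀ (bs : List (BExp n)) → σ ⊨ᵇ ⋀ bs ⇔ All (σ ⊨ᵇ_) bs
⊨ᵇ-⋀ []       = mk⇔ (λ _ → All.[]) (λ _ → tt)
⊨ᵇ-⋀ (b ∷ bs) = mk⇔ (λ (h , hs) → h All.∷ Equivalence.to (⊨ᵇ-⋀ bs) hs)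
                    (λ { (h All.∷ hs) → h , Equivalence.from (⊨ᵇ-⋀ bs) hs })

letterᵇ : Letter n → BExp n
letterᵇ σ = ⋀ (tabulate (λ i → literal i (lookup σ i)))

⊨ᵇ-letterᵇ : σ′ ⊨ᵇ letterᵇ σ ⇔ σ′ ≡ σ
⊨ᵇ-letterᵇ {σ′ = σ′} {σ = σ} = mk⇔ to from
  where
    to : σ′ ⊨ᵇ letterᵇ σ → σ′ ≡ σ
    to h = trans (sym (tabulate∘lookup σ′)) (trans (tabulate-cong agree) (tabulate∘lookup σ))
      where
        agree : ∀ i → lookup σ′ i ≡ lookup σ i
        agree i = Equivalence.to (⊨ᵇ-literal (lookup σ i))
                    (AllP.tabulate⁻ (Equivalence.to (⊨ᵇ-⋀ (tabulate _)) h) i)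

    from : σ′ ≡ σ → σ′ ⊨ᵇ letterᵇ σ
    from refl = Equivalence.from (⊨ᵇ-⋀ (tabulate _))
                  (AllP.tabulate⁺ (λ i → Equivalence.from (⊨ᵇ-literal (lookup σ i)) refl))

Lang : ℕ → Set₁
Lang n = List (Letter n) → Set

infixr 6 _⋅_

_⋅_ : Lang n → Lang n → Lang n
(P ⋅ Q) w = ∃₂ λ u v → w ≡ u ++ v × P u × Q v

⋅-map : ∀ {P P′ Q Q′ : Lang n} → (∀ {u} → P u → P′ u) → (∀ {v} → Q v → Q′ v) →
        (P ⋅ Q) w → (P′ ⋅ Q′) w
⋅-map f g (u , v , eq , p , q) = u , v , eq , f p , g q

data Star (P : Lang n) : Lang n where
  []  : Star P []
  _∷_ : P u → Star P v → Star P (u ++ v)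

Star-map : ∀ {P Q : Lang n} → (∀ {u} → P u → Q u) → Star P w → Star Q w
Star-map f []       = []
Star-map f (p ∷ ps) = f p ∷ Star-map f ps

Star-++ : ∀ {P : Lang n} → Star P u → Star P v → Star P (u ++ v)
Star-++ []                             qs = qs
Star-++ {v = v} (_∷_ {u = u} {v = u′} p ps) qs =
  subst (Star _) (sym (++-assoc u u′ v)) (p ∷ Star-++ ps qs)

ε : SchEx n
ε = lit (notᵇ trueᵇ) ⋆

∈L-ε⁻ : w ∈L ε → w ≡ []
∈L-ε⁻ nil⋆                = refl
∈L-ε⁻ (cons⋆ (lit∈ ¬⊤) _) = ⊥-elim (¬⊤ tt)

exact : List (Letter n) → SchEx n
exact []      = ε
exact (σ ∷ w) = lit (letterᵇ σ) · exact w

∈L-exact⁺ : ∀ (w : List (Letter n)) → w ∈L exact w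
∈L-exact⁺ []      = nil⋆
∈L-exact⁺ (σ ∷ w) = cat∈ (lit∈ (Equivalence.from ⊨ᵇ-letterᵇ refl)) (∈L-exact⁺ w)

∈L-exact⁻ : ∀ (w : List (Letter n)) → u ∈L exact w → u ≡ w
∈L-exact⁻ []      h                    = ∈L-ε⁻ h
∈L-exact⁻ (σ ∷ w) (cat∈ (lit∈ h) hw) = cong₂ _∷_ (Equivalence.to ⊨ᵇ-letterᵇ h) (∈L-exact⁻ w hw)

infix 4 _∈U_

_∈U_ : List (Letter n) → List (SchEx n) → Set
w ∈U rs = Any (w ∈L_) rs

infixr 6 _·U_

_·U_ : List (SchEx n) → List (SchEx n) → List (SchEx n)
_·U_ = cartesianProductWith _·_

·U⁺ : ((_∈U rs) ⋅ (_∈U ss)) w → w ∈U rs ·U ss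
·U⁺ (_ , _ , refl , hu , hv) = Any.cartesianProductWith⁺ _·_ cat∈ hu hv

·U⁻ : w ∈U rs ·U ss → ((_∈U rs) ⋅ (_∈U ss)) w
·U⁻ {rs = rs} {ss = ss} h with find h
... | _ , e∈ , he with ∈-cartesianProductWith⁻ _·_ rs ss e∈
... | _ , _ , r∈ , s∈ , refl with he
... | cat∈ hu hv = _ , _ , refl , lose r∈ hu , lose s∈ hv

stars : List (SchEx n) → SchEx n
stars = foldr (λ r e → (r ⋆) · e) ε

[]∈L-stars : ∀ (rs : List (SchEx n)) → [] ∈L stars rs
[]∈L-stars []       = nil⋆
[]∈L-stars (r ∷ rs) = cat∈ nil⋆ ([]∈L-stars rs)

∈L-stars⁺ : w ∈U rs → w ∈L stars rs
∈L-stars⁺ {w = w} {rs = r ∷ rs} (here h) =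
  subst (_∈L stars (r ∷ rs)) (trans (++-identityʳ (w ++ [])) (++-identityʳ w))
        (cat∈ (cons⋆ h nil⋆) ([]∈L-stars rs))
∈L-stars⁺ (there h) = cat∈ nil⋆ (∈L-stars⁺ h)

∈L-⋆⁻ : w ∈L (r ⋆) → Star (_∈L r) w
∈L-⋆⁻ nil⋆         = []
∈L-⋆⁻ (cons⋆ h hs) = h ∷ ∈L-⋆⁻ hs

∈L-stars⁻ : w ∈L stars rs → Star (_∈U rs) w
∈L-stars⁻ {rs = []}    h with refl ← ∈L-ε⁻ h = []
∈L-stars⁻ {rs = r ∷ rs} (cat∈ h hs) =
  Star-++ (Star-map here (∈L-⋆⁻ h)) (Star-map there (∈L-stars⁻ hs))

infix 8 _⋆U

_⋆U : List (SchEx n) → List (SchEx n)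
rs ⋆U = [ stars rs ⋆ ]

⋆U⁺ : Star (_∈U rs) w → w ∈U rs ⋆U
⋆U⁺ = here ∘ go
  where
    go : Star (_∈U rs) w → w ∈L (stars rs ⋆)
    go []       = nil⋆
    go (h ∷ hs) = cons⋆ (∈L-stars⁺ h) (go hs)

⋆U⁻ : w ∈U rs ⋆U → Star (_∈U rs) w
⋆U⁻ (here h) = go h
  where
    go : w ∈L (stars rs ⋆) → Star (_∈U rs) w
    go nil⋆         = []
    go (cons⋆ h hs) = Star-++ (∈L-stars⁻ h) (go hs)

module Kleene {n : ℕ} {Q : Set} (finite : Finite Q) (δ : Letter n → Q → Q) where

  open Finite finite

  private
    variable
      a c : Letter n
      x i j k : Q
      S S′ : List Q
      m u′ v′ w′ : List (Letter n)

  run : List (Letter n) → Q → Q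
  run w q = foldr δ q w

  -- run reads a word from its last letter.  Path S j w i: the run on w from j
  -- ends in i and passes only through states of S strictly in between.
  data Path (S : List Q) : Q → List (Letter n) → Q → Set where
    empty  : Path S j [] j
    single : Path S j [ a ] (δ a j)
    extend : k ∈ S → Path S j (c ∷ w′) k → Path S j (a ∷ c ∷ w′) (δ a k)

  Path-∷ : k ∈ S → Path S j w′ k → Path S j (a ∷ w′) (δ a k)
  Path-∷ k∈S empty          = single
  Path-∷ k∈S p@single       = extend k∈S p
  Path-∷ k∈S p@(extend _ _) = extend k∈S p

  Path-mono : (∀ {q} → q ∈ S → q ∈ S′) → Path S j w′ i → Path S′ j w′ i
  Path-mono S⊆S′ empty          = empty
  Path-mono S⊆S′ single         = single
  Path-mono S⊆S′ (extend k∈S p) = extend (S⊆S′ k∈S) (Path-mono S⊆S′ p)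

  compose : x ∈ S → Path S x u′ i → Path S j v′ x → Path S j (u′ ++ v′) i
  compose x∈S empty          q = q
  compose x∈S single         q = Path-∷ x∈S q
  compose x∈S (extend k∈S p) q = extend k∈S (compose x∈S p q)

  compose-loops : x ∈ S → Star (λ m → Path S x m x) m → Path S x m x
  compose-loops x∈S []       = empty
  compose-loops x∈S (p ∷ ps) = compose x∈S p (compose-loops x∈S ps)

  path-run : Path S j w′ i → run w′ j ≡ i
  path-run empty        = refl
  path-run single       = refl
  path-run (extend _ p) = cong (δ _) (path-run p)

  run-path : ∀ w′ j → Path elements j w′ (run w′ j)
  run-path []       j = empty
  run-path (a ∷ w′) j = Path-∷ (complete _) (run-path w′ j)

  Through : List Q → Q → Q → Q → Lang n
  Through S x j i = (λ u → Path S x u i) ⋅ Star (λ m → Path S x m x) ⋅ (λ v → Path S j v x)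

  through-path : Through S x j i w′ → Path (x ∷ S) j w′ i
  through-path (_ , _ , refl , pu , _ , _ , refl , ms , pv) =
    compose x∈ (Path-mono there pu)
      (compose x∈ (compose-loops x∈ (Star-map (Path-mono there) ms)) (Path-mono there pv))
    where x∈ = here refl

  path-through : Path (x ∷ S) j w′ i → Path S j w′ i ⊎ Through S x j i w′
  path-through empty  = inj₁ empty
  path-through single = inj₁ single
  path-through (extend k∈ p) with path-through p | k∈
  ... | inj₁ p′ | here refl = inj₂ (_ , _ , refl , single , [] , _ , refl , [] , p′)
  ... | inj₁ p′ | there k∈S = inj₁ (extend k∈S p′)
  ... | inj₂ (u , _ , eq , pu , m , v , refl , ms , pv) | here refl =
    inj₂ (_ , _ , refl , single , u ++ m , v , trans eq (sym (++-assoc u m v)) , pu ∷ ms , pv)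
  ... | inj₂ (u , mv , eq , pu , rest) | there k∈S =
    inj₂ (_ , mv , cong (_ ∷_) eq , Path-∷ k∈S pu , rest)

  shortWords : List (List (Letter n))
  shortWords = [] ∷ map [_] (Finite.elements (finite-Letter n))

  short-path : w′ ∈ shortWords → Path S j w′ (run w′ j)
  short-path (here refl) = empty
  short-path (there w∈) with ∈-map⁻ [_] w∈
  ... | _ , _ , refl = single

  path-short : Path [] j w′ i → w′ ∈ shortWords
  path-short empty          = here refl
  path-short (single {a = a}) = there (∈-map⁺ [_] (Finite.complete (finite-Letter n) a))
  path-short (extend () _)

  R : List Q → Q → Q → List (SchEx n)
  R []      i j = map exact (filter (λ v → run v j ≟ i) shortWords)
  R (x ∷ S) i j = R S i j ++ R S i x ·U R S x x ⋆U ·U R S x j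

  R-sound : ∀ S → w′ ∈U R S i j → Path S j w′ i
  R-sound {i = i} {j = j} [] h with find (Any.map⁻ h)
  ... | v , v∈ , hv with ∈-filter⁻ (λ v → run v j ≟ i) v∈
  ... | v∈short , refl with refl ← ∈L-exact⁻ v hv = short-path v∈short
  R-sound {i = i} {j = j} (x ∷ S) h with Any.++⁻ (R S i j) h
  ... | inj₁ h′ = Path-mono there (R-sound S h′)
  ... | inj₂ h′ =
    through-path
      (⋅-map (R-sound S) (⋅-map (Star-map (R-sound S) ∘ ⋆U⁻) (R-sound S) ∘ ·U⁻) (·U⁻ h′))

  R-complete : ∀ S → Path S j w′ i → w′ ∈U R S i j
  R-complete {j = j} {w′ = w′} {i = i} [] p =
    Any.map⁺ (lose (∈-filter⁺ (λ v → run v j ≟ i) (path-short p) (path-run p)) (∈L-exact⁺ w′))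
  R-complete {j = j} {i = i} (x ∷ S) p with path-through p
  ... | inj₁ p′ = Any.++⁺ˡ (R-complete S p′)
  ... | inj₂ t  = Any.++⁺ʳ (R S i j)
    (·U⁺ (⋅-map (R-complete S) (·U⁺ ∘ ⋅-map (⋆U⁺ ∘ Star-map (R-complete S)) (R-complete S)) t))

  language : Q → Q → List (SchEx n)
  language i j = R elements i j

  ∈-language : w′ ∈U language i j ⇔ run w′ j ≡ i
  ∈-language = mk⇔ (path-run ∘ R-sound elements) (λ { refl → R-complete elements (run-path _ _) })

record Recognizer (L : Lang n) : Set₁ where
  field
    State      : Set
    finite     : Finite State
    step       : Letter n → State → State
    initial    : State
    accepting  : State → Bool
    recognizes : ∀ w → L w ⇔ T (accepting (foldr step initial w))

sign : Bool → Label
sign true  = pos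
sign false = neg

Fits-sign⁺ : ∀ {ψ : LTL n} b → (∀ w → w ∈L r → w ∈⟦ ψ ⟧ ⇔ T b) → Fits ψ (r , sign b)
Fits-sign⁺ true  agree w w∈r = Equivalence.from (agree w w∈r) tt
Fits-sign⁺ false agree w w∈r = Equivalence.to (agree w w∈r)

Fits-sign⁻ : ∀ {ψ : LTL n} b → Fits ψ (r , sign b) → w ∈L r → w ∈⟦ ψ ⟧ ⇔ T b
Fits-sign⁻ true  fits w∈r = mk⇔ (λ _ → tt) (λ _ → fits _ w∈r)
Fits-sign⁻ false fits w∈r = mk⇔ (fits _ w∈r) (λ ())

module CharacteristicSample {φ : LTL n} (A : Recognizer (_∈⟦ φ ⟧)) where

  open Recognizer A
  open Kleene finite step

  examples : State → List (LabeledEx n)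
  examples q = map (_, sign (accepting q)) (language q initial)

  sample : List (LabeledEx n)
  sample = concatMap examples (Finite.elements finite)

  ∈-sample⁺ : ∀ {q} → r ∈ language q initial → (r , sign (accepting q)) ∈ sample
  ∈-sample⁺ {q = q} r∈ =
    ∈-concatMap⁺ examples (lose (Finite.complete finite q) (∈-map⁺ (_, sign (accepting q)) r∈))

  ∈-sample⁻ : ∀ {e} → e ∈ sample →
              ∃₂ λ q r → r ∈ language q initial × e ≡ (r , sign (accepting q))
  ∈-sample⁻ e∈ with find (∈-concatMap⁻ examples {xs = Finite.elements finite} e∈)
  ... | q , _ , e∈examples with ∈-map⁻ _ e∈examples
  ... | r , r∈ , eq = q , r , r∈ , eq

  sample-fits : All (Fits φ) sample
  sample-fits = All.tabulate fits
    where
      fits : ∀ {e} → e ∈ sample → Fits φ e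
      fits e∈ with ∈-sample⁻ e∈
      ... | q , r , r∈ , refl = Fits-sign⁺ (accepting q) λ w w∈r →
        subst (λ q′ → w ∈⟦ φ ⟧ ⇔ T (accepting q′))
              (Equivalence.to ∈-language (lose r∈ w∈r)) (recognizes w)

  sample-characterises : ∀ ψ → All (Fits ψ) sample → ∀ w → (w ⊨ ψ) ⇔ (w ⊨ φ)
  sample-characterises ψ fits (a ∷⁺ as)
    with find (Equivalence.from (∈-language {w′ = a ∷ as}) refl)
  ... | r , r∈ , w∈r =
    ⇔-trans (Fits-sign⁻ _ (All.lookup fits (∈-sample⁺ r∈)) w∈r) (⇔-sym (recognizes (a ∷ as)))

Xₗ-expansion : ∀ {φ : LTL n} a as → (a ∷ as) ∈⟦ Xₗ φ ⟧ ⇔ as ∈⟦ φ ⟧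
Xₗ-expansion a []       = mk⇔ (λ { (s≤s () , _) }) (λ ())
Xₗ-expansion a (b ∷ bs) = mk⇔ proj₂ (s≤s (s≤s z≤n) ,_)

Fₗ-expansion : ∀ {φ : LTL n} a as → (a ∷ as) ∈⟦ Fₗ φ ⟧ ⇔ ((a ∷ as) ∈⟦ φ ⟧ ⊎ as ∈⟦ Fₗ φ ⟧)
Fₗ-expansion a [] = mk⇔ (λ { (zero , h) → inj₁ h }) (λ { (inj₁ h) → zero , h })
Fₗ-expansion a (b ∷ bs) =
  mk⇔ (λ { (zero , h) → inj₁ h ; (suc i , h) → inj₂ (i , h) })
      (λ { (inj₁ h) → zero , h ; (inj₂ (i , h)) → suc i , h })

Uₗ-expansion : ∀ {φ ψ : LTL n} a as →
  (a ∷ as) ∈⟦ φ Uₗ ψ ⟧ ⇔ ((a ∷ as) ∈⟦ ψ ⟧ ⊎ ((a ∷ as) ∈⟦ φ ⟧ × as ∈⟦ φ Uₗ ψ ⟧))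
Uₗ-expansion a [] = mk⇔ (λ { (zero , h , _) → inj₁ h }) (λ { (inj₁ h) → zero , h , λ _ () })
Uₗ-expansion a (b ∷ bs) =
  mk⇔ (λ { (zero , h , _) → inj₁ h
         ; (suc j , h , before) →
             inj₂ (before zero (s≤s z≤n) , j , h , λ i i<j → before (suc i) (s≤s i<j)) })
      (λ { (inj₁ h) → zero , h , λ _ ()
         ; (inj₂ (h , j , h′ , before)) →
             suc j , h′ , λ { zero _ → h ; (suc i) (s≤s i<j) → before i i<j } })

holds : LTL n → List (Letter n) → Bool
holds φ         []      = false
holds ⊤ₗ        (σ ∷ w) = true
holds (atom p)  (σ ∷ w) = lookup σ p
holds (¬ₗ φ)    (σ ∷ w) = not (holds φ (σ ∷ w))
holds (φ ∧ₗ ψ)  (σ ∷ w) = holds φ (σ ∷ w) ∧ holds ψ (σ ∷ w)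
holds (Xₗ φ)    (σ ∷ w) = holds φ w
holds (Fₗ φ)    (σ ∷ w) = holds φ (σ ∷ w) ∨ holds (Fₗ φ) w
holds (φ Uₗ ψ)  (σ ∷ w) = holds ψ (σ ∷ w) ∨ (holds φ (σ ∷ w) ∧ holds (φ Uₗ ψ) w)

T-not : ∀ x → T (not x) ⇔ (¬ T x)
T-not true  = mk⇔ (λ ()) (λ ¬t → ¬t tt)
T-not false = mk⇔ (λ _ ()) (λ _ → tt)

T-holds : ∀ φ (w : List (Letter n)) → T (holds φ w) ⇔ w ∈⟦ φ ⟧
T-holds φ        []       = mk⇔ (λ ()) (λ ())
T-holds ⊤ₗ       (σ ∷ w)  = mk⇔ (λ _ → tt) (λ _ → tt)
T-holds (atom p) (σ ∷ w)  = ⇔-sym (⇔-trans ∈ₛ⇔lookup (⇔-sym Bool.T-≡))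
T-holds (¬ₗ φ)   (σ ∷ w)  = ⇔-trans (T-not _) (¬-cong-⇔ (T-holds φ (σ ∷ w)))
T-holds (φ ∧ₗ ψ) (σ ∷ w)  = ⇔-trans Bool.T-∧ (T-holds φ (σ ∷ w) ×-⇔ T-holds ψ (σ ∷ w))
T-holds (Xₗ φ)   (σ ∷ w)  = ⇔-trans (T-holds φ w) (⇔-sym (Xₗ-expansion σ w))
T-holds (Fₗ φ)   (σ ∷ w)  =
  ⇔-trans Bool.T-∨ (⇔-trans (T-holds φ (σ ∷ w) ⊎-⇔ T-holds (Fₗ φ) w) (⇔-sym (Fₗ-expansion σ w)))
T-holds (φ Uₗ ψ) (σ ∷ w)  =
  ⇔-trans Bool.T-∨
    (⇔-trans (T-holds ψ (σ ∷ w) ⊎-⇔ ⇔-trans Bool.T-∧ (T-holds φ (σ ∷ w) ×-⇔ T-holds (φ Uₗ ψ) w))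
             (⇔-sym (Uₗ-expansion σ w)))

mutual
  Val : LTL n → Set
  Val φ = Bool × SubVal φ

  SubVal : LTL n → Set
  SubVal ⊤ₗ       = ⊤
  SubVal (atom _) = ⊤
  SubVal (¬ₗ φ)   = Val φ
  SubVal (φ ∧ₗ ψ) = Val φ × Val ψ
  SubVal (Xₗ φ)   = Val φ
  SubVal (Fₗ φ)   = Val φ
  SubVal (φ Uₗ ψ) = Val φ × Val ψ

mutual
  val : ∀ (φ : LTL n) → List (Letter n) → Val φ
  val φ w = holds φ w , subval φ w

  subval : ∀ (φ : LTL n) → List (Letter n) → SubVal φ
  subval ⊤ₗ       w = tt
  subval (atom _) w = tt
  subval (¬ₗ φ)   w = val φ w
  subval (φ ∧ₗ ψ) w = val φ w , val ψ w
  subval (Xₗ φ)   w = val φ w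
  subval (Fₗ φ)   w = val φ w
  subval (φ Uₗ ψ) w = val φ w , val ψ w

update : ∀ (φ : LTL n) → Letter n → Val φ → Val φ
update ⊤ₗ       σ _           = true , tt
update (atom p) σ _           = lookup σ p , tt
update (¬ₗ φ)   σ (_ , v)     = not (proj₁ v′) , v′
  where v′ = update φ σ v
update (φ ∧ₗ ψ) σ (_ , v , u) = proj₁ v′ ∧ proj₁ u′ , v′ , u′
  where v′ = update φ σ v
        u′ = update ψ σ u
update (Xₗ φ)   σ (_ , v)     = proj₁ v , update φ σ v
update (Fₗ φ)   σ (b , v)     = proj₁ v′ ∨ b , v′
  where v′ = update φ σ v
update (φ Uₗ ψ) σ (b , v , u) = proj₁ u′ ∨ (proj₁ v′ ∧ b) , v′ , u′
  where v′ = update φ σ v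
        u′ = update ψ σ u

val-∷ : ∀ (φ : LTL n) σ w → val φ (σ ∷ w) ≡ update φ σ (val φ w)
val-∷ ⊤ₗ       σ w = refl
val-∷ (atom p) σ w = refl
val-∷ (¬ₗ φ)   σ w = cong (λ v → not (proj₁ v) , v) (val-∷ φ σ w)
val-∷ (φ ∧ₗ ψ) σ w = cong₂ (λ v u → proj₁ v ∧ proj₁ u , v , u) (val-∷ φ σ w) (val-∷ ψ σ w)
val-∷ (Xₗ φ)   σ w = cong (holds φ w ,_) (val-∷ φ σ w)
val-∷ (Fₗ φ)   σ w = cong (λ v → proj₁ v ∨ holds (Fₗ φ) w , v) (val-∷ φ σ w)
val-∷ (φ Uₗ ψ) σ w =
  cong₂ (λ v u → proj₁ u ∨ (proj₁ v ∧ holds (φ Uₗ ψ) w) , v , u) (val-∷ φ σ w) (val-∷ ψ σ w)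

val-run : ∀ (φ : LTL n) w → val φ w ≡ foldr (update φ) (val φ []) w
val-run φ []      = refl
val-run φ (σ ∷ w) = trans (val-∷ φ σ w) (cong (update φ σ) (val-run φ w))

mutual
  finite-Val : ∀ (φ : LTL n) → Finite (Val φ)
  finite-Val φ = finite-× finite-Bool (finite-SubVal φ)

  finite-SubVal : ∀ (φ : LTL n) → Finite (SubVal φ)
  finite-SubVal ⊤ₗ       = finite-⊤
  finite-SubVal (atom _) = finite-⊤
  finite-SubVal (¬ₗ φ)   = finite-Val φ
  finite-SubVal (φ ∧ₗ ψ) = finite-× (finite-Val φ) (finite-Val ψ)
  finite-SubVal (Xₗ φ)   = finite-Val φ
  finite-SubVal (Fₗ φ)   = finite-Val φ
  finite-SubVal (φ Uₗ ψ) = finite-× (finite-Val φ) (finite-Val ψ)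

ltl-recognizer : ∀ (φ : LTL n) → Recognizer (_∈⟦ φ ⟧)
ltl-recognizer φ = record
  { State      = Val φ
  ; finite     = finite-Val φ
  ; step       = update φ
  ; initial    = val φ []
  ; accepting  = proj₁
  ; recognizes = λ w → subst (λ v → w ∈⟦ φ ⟧ ⇔ T (proj₁ v)) (val-run φ w) (⇔-sym (T-holds φ w))
  }

theorem26 : (n : ℕ) → (φ : LTL n) →
    Σ (List (LabeledEx n)) λ E →
    All (Fits φ) E ×
    ((ψ : LTL n) → All (Fits ψ) E → (w : Word n) → (w ⊨ ψ) ⇔ (w ⊨ φ))
theorem26 n φ = sample , sample-fits , sample-characterises
  where open CharacteristicSample (ltl-recognizer φ)
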